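{- Let $n$ and $h$ be positive integers with $n>2h$. If $\mathcal{V}_q(h,n)$ exists, then $$\log_q\mathcal{B}_q(n,2h+1)\leq n-\mathcal{V}_q(h,n).$$
   Context: $\mathcal{B}_q(n,d)=\max\{|\mathcal{C}|:\mathcal{C}\subseteq\mathbb{F}_q^n \text{ a } q\text{ -linear code (subspace) with minimum distance } d(\mathcal{C})\geq d\}$, where the minimum distance is the minimum Hamming weight of a non-zero codeword. $\mathcal{V}_q(h,n)=\min\{r: 2h\leq r<n,\ \mathbb{F}_q^r \text{ contains an } S_h\text{ -set with } n+1 \text{ elements}\}$, where a subset $S$ of the additive group $\mathbb{F}_q^r$ is an $S_h$-set if all sums $x_{i_1}+\cdots+x_{i_h}$ of $h$ distinct elements of $S$ (with $i_1<\cdots<i_h$) are distinct. -}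

module Defs where

open import Level using (0ℓ)
open import Data.Nat using (ℕ; zero; suc; _≤_; _<_)
open import Data.Bool using (Bool; true; false)
open import Data.Fin using (Fin)
open import Data.Fin.Subset using (Subset; ∣_∣)
open import Data.Vec using (Vec; []; _∷_; replicate; zipWith; map; lookup)
open import Data.List using (List)
open import Data.List.Membership.Propositional using (_∈_)
open import Data.List.Relation.Unary.Unique.Propositional using (Unique)
open import Data.Product using (Σ; ∃; _×_)
open import Function.Bundles using (_↔_)
open import Function.Definitions using (Injective)
open import Algebra.Structures using (IsCommutativeRing)
open import Relation.Binary.PropositionalEquality using (_≡_; _≢_)
open import Relation.Binary.Definitions using (DecidableEquality)
open import Relation.Nullary using (¬_; yes; no)

-- A finite field with exactly q elements (equality is propositional).
-- Every finite field has decidable equality; we record it as a field for convenience.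
record FiniteField (q : ℕ) : Set₁ where
  field
    F    : Set
    _+_  : F → F → F
    _*_  : F → F → F
    -_   : F → F
    0#   : F
    1#   : F
    isCommutativeRing : IsCommutativeRing _≡_ _+_ _*_ -_ 0# 1#
    0≢1     : 0# ≢ 1#
    inverse : ∀ x → x ≢ 0# → ∃ λ y → (x * y) ≡ 1#
    enum    : Fin q ↔ F
    _≟_     : DecidableEquality F

module _ {q : ℕ} (𝔽 : FiniteField q) where
  open FiniteField 𝔽

  Vect : ℕ → Set
  Vect n = Vec F n

  zeroV : ∀ {n} → Vect n
  zeroV = replicate _ 0#

  _⊕_ : ∀ {n} → Vect n → Vect n → Vect n
  _⊕_ = zipWith _+_

  _⊙_ : ∀ {n} → F → Vect n → Vect n
  a ⊙ v = map (a *_) v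

  wt : ∀ {n} → Vect n → ℕ
  wt [] = 0
  wt (x ∷ v) with x ≟ 0#
  ... | yes _ = wt v
  ... | no  _ = suc (wt v)

  -- A q-linear code of length n, given as the (duplicate-free) list of all its codewords,
  -- which must form an F_q-subspace of F_q^n.
  record LinearCode (n : ℕ) : Set where
    field
      words   : List (Vect n)
      unique  : Unique words
      has-0   : zeroV ∈ words
      closed+ : ∀ {x y} → x ∈ words → y ∈ words → (x ⊕ y) ∈ words
      closed· : ∀ a {x} → x ∈ words → (a ⊙ x) ∈ words

  MinDist≥ : ∀ {n} → LinearCode n → ℕ → Set
  MinDist≥ C d = ∀ {c} → c ∈ LinearCode.words C → c ≢ zeroV → d ≤ wt c

  subsetSum : ∀ {m r} → Subset m → Vec (Vect r) m → Vect r
  subsetSum []          []       = zeroV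
  subsetSum (true  ∷ s) (x ∷ xs) = x ⊕ subsetSum s xs
  subsetSum (false ∷ s) (x ∷ xs) = subsetSum s xs

  IsShSet : ∀ {m r} → ℕ → Vec (Vect r) m → Set
  IsShSet h xs =
    Injective _≡_ _≡_ (λ i → lookup xs i) ×
    (∀ (I J : Subset _) → ∣ I ∣ ≡ h → ∣ J ∣ ≡ h → subsetSum I xs ≡ subsetSum J xs → I ≡ J)

  HasShSet : (h m r : ℕ) → Set
  HasShSet h m r = Σ (Vec (Vect r) m) (IsShSet h)

  IsV : (h n r : ℕ) → Set
  IsV h n r =
    (2 Data.Nat.* h ≤ r) × (r < n) × HasShSet h (suc n) r ×
    (∀ r′ → 2 Data.Nat.* h ≤ r′ → r′ < r → ¬ HasShSet h (suc n) r′)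

-- Let C be a linear code of length n with minimum distance at least 2h+1, and let
-- s : F_q^n → F_q^ρ be a parity-check map of C, i.e. a linear map whose kernel lies in C
-- (Gaussian elimination produces one with |C| ≤ q^(n-ρ)). The n+1 points s(0), s(e_1), …,
-- s(e_n) form an S_h-set: two different subsets of at most h unit vectors with the same
-- image under s differ by a nonzero codeword of weight at most 2h. After embedding F_q^ρ
-- into F_q^(max(2h,ρ)), minimality of r = V_q(h,n) gives r ≤ max(2h, ρ). If ρ ≥ 2h this is
-- |C| ≤ q^(n-ρ) ≤ q^(n-r); otherwise r = 2h and the Singleton bound |C| ≤ q^(n-2h) applies.
module Submission where

open import Level using (0ℓ)
open import Algebra.Bundles using (CommutativeRing)
open import Data.Bool as Bool using (Bool; true; false)
open import Data.Fin as Fin using (Fin; zero; suc; combine; toℕ)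
import Data.Fin.Properties as Finₚ
open import Data.Fin.Subset as Subset using (Subset; ∣_∣; ⁅_⁆)
import Data.Fin.Subset.Properties as Subsetₚ
open import Data.List as List using (List; []; _∷_; filter)
import Data.List.Relation.Unary.All as All
import Data.List.Relation.Unary.Any as Any
open import Data.List.Relation.Unary.AllPairs using (_∷_)
open import Data.List.Relation.Unary.Unique.Propositional using (Unique)
open import Data.List.Membership.Propositional using (_∈_; find)
import Data.List.Membership.Propositional.Properties as ∈ₚ
open import Data.Nat as ℕ using (ℕ; zero; suc; _∸_; _≤_; _<_; z≤n; s≤s; NonZero)
import Data.Nat.Properties as ℕₚ
open import Data.Product using (∃; _×_; _,_; proj₂)
open import Data.Sum using ([_,_])
open import Data.Vec as Vec using (Vec; []; _∷_)
import Data.Vec.Properties as Vecₚ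
open import Function.Base using (_∘_)
open import Function.Bundles using (Inverse)
open import Relation.Binary.PropositionalEquality hiding ([_])
open import Relation.Nullary using (Dec; yes; no; ¬?)
open import Relation.Nullary.Decidable using (decidable-stable)
open import Relation.Nullary.Negation using (contradiction)

open import Defs

module Coding {q : ℕ} (𝔽 : FiniteField q) where

  open FiniteField 𝔽 using (F; isCommutativeRing; 0≢1; inverse; enum; _≟_)

  commutativeRing : CommutativeRing 0ℓ 0ℓ
  commutativeRing = record { isCommutativeRing = isCommutativeRing }

  open CommutativeRing commutativeRing
    hiding (zero; refl; sym; trans; reflexive; isEquivalence; setoid)
  open import Algebra.Properties.Ring ring using (-1*x≈-x; -‿distribʳ-*)
  open import Algebra.Properties.AbelianGroup +-abelianGroup using (⁻¹-∙-comm; x∙y⁻¹≈ε⇒x≈y)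
  open import Algebra.Properties.CommutativeSemigroup +-commutativeSemigroup using (interchange)
  open ≡-Reasoning

  x-x≡0 : ∀ x → x + - 1# * x ≡ 0#
  x-x≡0 x = trans (cong (x +_) (-1*x≈-x x)) (-‿inverseʳ x)

  x-y≡0⇒x≡y : ∀ x y → x + - 1# * y ≡ 0# → x ≡ y
  x-y≡0⇒x≡y x y eq = x∙y⁻¹≈ε⇒x≈y x y (trans (cong (x +_) (sym (-1*x≈-x y))) eq)

  shear-+ : ∀ v u x y w → (v + u) + - (x + y) * w ≡ (v + - x * w) + (u + - y * w)
  shear-+ v u x y w = begin
    (v + u) + - (x + y) * w        ≡⟨ cong (λ z → (v + u) + z * w) (sym (⁻¹-∙-comm x y)) ⟩
    (v + u) + (- x + - y) * w      ≡⟨ cong ((v + u) +_) (distribʳ w (- x) (- y)) ⟩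
    (v + u) + (- x * w + - y * w)  ≡⟨ interchange v u (- x * w) (- y * w) ⟩
    (v + - x * w) + (u + - y * w)  ∎

  shear-* : ∀ a v x w → a * (v + - x * w) ≡ a * v + - (a * x) * w
  shear-* a v x w = begin
    a * (v + - x * w)      ≡⟨ distribˡ a v (- x * w) ⟩
    a * v + a * (- x * w)  ≡⟨ cong (a * v +_) (sym (*-assoc a (- x) w)) ⟩
    a * v + a * - x * w    ≡⟨ cong (λ z → a * v + z * w) (sym (-‿distribʳ-* a x)) ⟩
    a * v + - (a * x) * w  ∎

  unshear : ∀ v x w → (v + - x * w) + x * w ≡ v
  unshear v x w = begin
    (v + - x * w) + x * w  ≡⟨ +-assoc v (- x * w) (x * w) ⟩
    v + (- x * w + x * w)  ≡⟨ cong (v +_) (sym (distribʳ w (- x) x)) ⟩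
    v + (- x + x) * w      ≡⟨ cong (λ z → v + z * w) (-‿inverseˡ x) ⟩
    v + 0# * w             ≡⟨ cong (v +_) (zeroˡ w) ⟩
    v + 0#                 ≡⟨ +-identityʳ v ⟩
    v                      ∎

  Vt : ℕ → Set
  Vt = Vect 𝔽

  𝟎 : ∀ {n} → Vt n
  𝟎 = zeroV 𝔽

  infixl 6 _⊞_ _⊟_
  infixr 7 _⊡_

  _⊞_ : ∀ {n} → Vt n → Vt n → Vt n
  _⊞_ = _⊕_ 𝔽

  _⊡_ : ∀ {n} → F → Vt n → Vt n
  _⊡_ = _⊙_ 𝔽

  _⊟_ : ∀ {n} → Vt n → Vt n → Vt n
  x ⊟ y = x ⊞ - 1# ⊡ y

  ⊞-identityˡ : ∀ {n} (x : Vt n) → 𝟎 ⊞ x ≡ x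
  ⊞-identityˡ = Vecₚ.zipWith-identityˡ +-identityˡ

  ⊞-identityʳ : ∀ {n} (x : Vt n) → x ⊞ 𝟎 ≡ x
  ⊞-identityʳ = Vecₚ.zipWith-identityʳ +-identityʳ

  ⊡-zeroˡ : ∀ {n} (x : Vt n) → 0# ⊡ x ≡ 𝟎
  ⊡-zeroˡ x = trans (Vecₚ.map-cong zeroˡ x) (Vecₚ.map-const x 0#)

  ⊡-zeroʳ : ∀ {n} a → a ⊡ 𝟎 {n} ≡ 𝟎
  ⊡-zeroʳ {n} a = trans (Vecₚ.map-replicate (a *_) 0# n) (cong (Vec.replicate n) (zeroʳ a))

  ⊟-self : ∀ {n} (x : Vt n) → x ⊟ x ≡ 𝟎
  ⊟-self []      = refl
  ⊟-self (a ∷ x) = cong₂ _∷_ (x-x≡0 a) (⊟-self x)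

  ⊟≡𝟎⇒≡ : ∀ {n} (x y : Vt n) → x ⊟ y ≡ 𝟎 → x ≡ y
  ⊟≡𝟎⇒≡ []      []      _  = refl
  ⊟≡𝟎⇒≡ (a ∷ x) (b ∷ y) eq =
    cong₂ _∷_ (x-y≡0⇒x≡y a b (Vecₚ.∷-injectiveˡ eq)) (⊟≡𝟎⇒≡ x y (Vecₚ.∷-injectiveʳ eq))

  shear-⊞ : ∀ {n} (v u w : Vt n) x y → (v ⊞ u) ⊞ - (x + y) ⊡ w ≡ (v ⊞ - x ⊡ w) ⊞ (u ⊞ - y ⊡ w)
  shear-⊞ []      []      []      x y = refl
  shear-⊞ (a ∷ v) (b ∷ u) (c ∷ w) x y = cong₂ _∷_ (shear-+ a b x y c) (shear-⊞ v u w x y)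

  shear-⊡ : ∀ {n} a (v w : Vt n) x → a ⊡ (v ⊞ - x ⊡ w) ≡ a ⊡ v ⊞ - (a * x) ⊡ w
  shear-⊡ a []      []      x = refl
  shear-⊡ a (b ∷ v) (c ∷ w) x = cong₂ _∷_ (shear-* a b x c) (shear-⊡ a v w x)

  unshear-⊞ : ∀ {n} (v w : Vt n) x → (v ⊞ - x ⊡ w) ⊞ x ⊡ w ≡ v
  unshear-⊞ []      []      x = refl
  unshear-⊞ (b ∷ v) (c ∷ w) x = cong₂ _∷_ (unshear b x c) (unshear-⊞ v w x)

  wt-∷-≤ : ∀ {n} x (v : Vt n) → wt 𝔽 (x ∷ v) ≤ suc (wt 𝔽 v)
  wt-∷-≤ x v with x ≟ 0#
  ... | yes _ = ℕₚ.n≤1+n _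
  ... | no  _ = ℕₚ.≤-refl

  wt-0∷ : ∀ {n} x (v : Vt n) → x ≡ 0# → wt 𝔽 (x ∷ v) ≡ wt 𝔽 v
  wt-0∷ x v x≡0 with x ≟ 0#
  ... | yes _  = refl
  ... | no x≢0 = contradiction x≡0 x≢0

  wt-𝟎 : ∀ n → wt 𝔽 (𝟎 {n}) ≡ 0
  wt-𝟎 zero    = refl
  wt-𝟎 (suc n) = trans (wt-0∷ 0# 𝟎 refl) (wt-𝟎 n)

  record Linear (n m : ℕ) : Set where
    field
      apply : Vt n → Vt m
      +-hom : ∀ x y → apply (x ⊞ y) ≡ apply x ⊞ apply y
      ·-hom : ∀ a x → apply (a ⊡ x) ≡ a ⊡ apply x

    0-hom : apply 𝟎 ≡ 𝟎
    0-hom = begin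
      apply 𝟎         ≡⟨ cong apply (sym (⊡-zeroˡ 𝟎)) ⟩
      apply (0# ⊡ 𝟎)  ≡⟨ ·-hom 0# 𝟎 ⟩
      0# ⊡ apply 𝟎    ≡⟨ ⊡-zeroˡ (apply 𝟎) ⟩
      𝟎               ∎

    ⊟-hom : ∀ x y → apply (x ⊟ y) ≡ apply x ⊟ apply y
    ⊟-hom x y = trans (+-hom x _) (cong (apply x ⊞_) (·-hom (- 1#) y))

  open Linear

  infixr 9 _∘ₗ_

  _∘ₗ_ : ∀ {n m k} → Linear m k → Linear n m → Linear n k
  g ∘ₗ f = record
    { apply = λ x → apply g (apply f x)
    ; +-hom = λ x y → trans (cong (apply g) (+-hom f x y)) (+-hom g _ _)
    ; ·-hom = λ a x → trans (cong (apply g) (·-hom f a x)) (·-hom g a _)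
    }

  idₗ : ∀ {n} → Linear n n
  idₗ = record { apply = λ x → x ; +-hom = λ _ _ → refl ; ·-hom = λ _ _ → refl }

  tailₗ : ∀ {n} → Linear (suc n) n
  tailₗ = record
    { apply = Vec.tail
    ; +-hom = λ { (_ ∷ _) (_ ∷ _) → refl }
    ; ·-hom = λ { _ (_ ∷ _) → refl }
    }

  consₗ : ∀ {n m} → Linear n m → Linear (suc n) (suc m)
  consₗ f = record
    { apply = λ { (x ∷ v) → x ∷ apply f v }
    ; +-hom = λ { (x ∷ v) (y ∷ u) → cong ((x + y) ∷_) (+-hom f v u) }
    ; ·-hom = λ { a (x ∷ v) → cong ((a * x) ∷_) (·-hom f a v) }
    }

  0∷ₗ : ∀ {n} → Linear n (suc n)
  0∷ₗ = record
    { apply = 0# ∷_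
    ; +-hom = λ x y → cong (_∷ (x ⊞ y)) (sym (+-identityˡ 0#))
    ; ·-hom = λ a x → cong (_∷ (a ⊡ x)) (sym (zeroʳ a))
    }

  -- Reduces x ∷ v against the pivot row 1 ∷ w, keeping the head x.
  shearₗ : ∀ {n} → Vt n → Linear (suc n) (suc n)
  shearₗ w = record
    { apply = λ { (x ∷ v) → x ∷ (v ⊞ - x ⊡ w) }
    ; +-hom = λ { (x ∷ v) (y ∷ u) → cong ((x + y) ∷_) (shear-⊞ v u w x y) }
    ; ·-hom = λ { a (x ∷ v) → cong ((a * x) ∷_) (sym (shear-⊡ a v w x)) }
    }

  embed : ∀ {n m} → n ≤ m → Vt n → Vt m
  embed z≤n       []      = 𝟎
  embed (s≤s n≤m) (x ∷ v) = x ∷ embed n≤m v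

  embedₗ : ∀ {n m} → n ≤ m → Linear n m
  embedₗ n≤m = record { apply = embed n≤m ; +-hom = hom+ n≤m ; ·-hom = hom· n≤m }
    where
    hom+ : ∀ {n m} (n≤m : n ≤ m) x y → embed n≤m (x ⊞ y) ≡ embed n≤m x ⊞ embed n≤m y
    hom+ z≤n       []      []      = sym (⊞-identityˡ 𝟎)
    hom+ (s≤s n≤m) (x ∷ v) (y ∷ u) = cong ((x + y) ∷_) (hom+ n≤m v u)
    hom· : ∀ {n m} (n≤m : n ≤ m) a x → embed n≤m (a ⊡ x) ≡ a ⊡ embed n≤m x
    hom· z≤n       a []      = sym (⊡-zeroʳ a)
    hom· (s≤s n≤m) a (x ∷ v) = cong ((a * x) ∷_) (hom· n≤m a v)

  embed-ker : ∀ {n m} (n≤m : n ≤ m) x → embed n≤m x ≡ 𝟎 → x ≡ 𝟎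
  embed-ker z≤n       []      _  = refl
  embed-ker (s≤s n≤m) (x ∷ v) eq =
    cong₂ _∷_ (Vecₚ.∷-injectiveˡ eq) (embed-ker n≤m v (Vecₚ.∷-injectiveʳ eq))

  dropV : ∀ d {n} → Vt n → Vt (n ∸ d)
  dropV zero    v       = v
  dropV (suc d) []      = []
  dropV (suc d) (x ∷ v) = dropV d v

  dropₗ : ∀ d {n} → Linear n (n ∸ d)
  dropₗ d = record { apply = dropV d ; +-hom = hom+ d ; ·-hom = hom· d }
    where
    hom+ : ∀ d {n} (x y : Vt n) → dropV d (x ⊞ y) ≡ dropV d x ⊞ dropV d y
    hom+ zero    x       y       = refl
    hom+ (suc d) []      []      = refl
    hom+ (suc d) (_ ∷ x) (_ ∷ y) = hom+ d x y
    hom· : ∀ d {n} a (x : Vt n) → dropV d (a ⊡ x) ≡ a ⊡ dropV d x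
    hom· zero    a x       = refl
    hom· (suc d) a []      = refl
    hom· (suc d) a (_ ∷ x) = hom· d a x

  wt-dropV : ∀ d {n} (v : Vt n) → wt 𝔽 v ≤ d ℕ.+ wt 𝔽 (dropV d v)
  wt-dropV zero    v       = ℕₚ.≤-refl
  wt-dropV (suc d) []      = z≤n
  wt-dropV (suc d) (x ∷ v) = ℕₚ.≤-trans (wt-∷-≤ x v) (s≤s (wt-dropV d v))

  record Subspace (n : ℕ) : Set where
    field
      elements : List (Vt n)
      𝟎∈       : 𝟎 ∈ elements
      ⊞-closed : ∀ {x y} → x ∈ elements → y ∈ elements → x ⊞ y ∈ elements
      ⊡-closed : ∀ a {x} → x ∈ elements → a ⊡ x ∈ elements

    ⊟-closed : ∀ {x y} → x ∈ elements → y ∈ elements → x ⊟ y ∈ elements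
    ⊟-closed x∈ y∈ = ⊞-closed x∈ (⊡-closed (- 1#) y∈)

  open Subspace

  infix 4 _∈ₛ_

  _∈ₛ_ : ∀ {n} → Vt n → Subspace n → Set
  x ∈ₛ S = x ∈ elements S

  codeSubspace : ∀ {n} → LinearCode 𝔽 n → Subspace n
  codeSubspace C = record
    { elements = words ; 𝟎∈ = has-0 ; ⊞-closed = closed+ ; ⊡-closed = closed· }
    where open LinearCode C

  head≟0 : ∀ {n} (x : Vt (suc n)) → Dec (Vec.head x ≡ 0#)
  head≟0 x = Vec.head x ≟ 0#

  module _ {n} (S : Subspace (suc n)) where

    sectionElements : List (Vt n)
    sectionElements = List.map Vec.tail (filter head≟0 (elements S))

    ∈-section⁺ : ∀ {v} → 0# ∷ v ∈ₛ S → v ∈ sectionElements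
    ∈-section⁺ v∈ = ∈ₚ.∈-map⁺ Vec.tail (∈ₚ.∈-filter⁺ head≟0 v∈ refl)

    ∈-section⁻ : ∀ {v} → v ∈ sectionElements → 0# ∷ v ∈ₛ S
    ∈-section⁻ v∈ with ∈ₚ.∈-map⁻ Vec.tail v∈
    ... | (_ ∷ _) , x∈ , refl with ∈ₚ.∈-filter⁻ head≟0 {xs = elements S} x∈
    ...   | x∈S , refl = x∈S

    section : Subspace n
    section = record
      { elements = sectionElements
      ; 𝟎∈       = ∈-section⁺ (𝟎∈ S)
      ; ⊞-closed = λ {x} {y} x∈ y∈ → ∈-section⁺
          (subst (λ z → z ∷ x ⊞ y ∈ₛ S) (+-identityˡ 0#) (⊞-closed S (∈-section⁻ x∈) (∈-section⁻ y∈)))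
      ; ⊡-closed = λ a {x} x∈ → ∈-section⁺
          (subst (λ z → z ∷ a ⊡ x ∈ₛ S) (zeroʳ a) (⊡-closed S a (∈-section⁻ x∈)))
      }

    normalisedPivot : Any.Any (λ x → Vec.head x ≢ 0#) (elements S) → ∃ λ w → 1# ∷ w ∈ₛ S
    normalisedPivot some with find some
    ... | c ∷ w , w∈ , c≢0 with inverse c c≢0
    ...   | c⁻¹ , c*c⁻¹≡1 =
      c⁻¹ ⊡ w , subst (λ z → z ∷ c⁻¹ ⊡ w ∈ₛ S) (trans (*-comm c⁻¹ c) c*c⁻¹≡1) (⊡-closed S c⁻¹ w∈)

  record ParityCheck {n} (S : Subspace n) : Set where
    field
      r k        : ℕ
      k+r≡n      : k ℕ.+ r ≡ n
      check      : Linear n r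
      check-ker  : ∀ x → apply check x ≡ 𝟎 → x ∈ₛ S
      coords     : Linear n k
      coords-ker : ∀ {x} → x ∈ₛ S → apply coords x ≡ 𝟎 → x ≡ 𝟎

  -- One step of Gaussian elimination on the first coordinate.
  module _ {n} {S : Subspace (suc n)} (P : ParityCheck (section S)) where

    private module P = ParityCheck P

    parityCheck-allHeadsZero : (∀ {x v} → x ∷ v ∈ₛ S → x ≡ 0#) → ParityCheck S
    parityCheck-allHeadsZero headsZero = record
      { r          = suc P.r
      ; k          = P.k
      ; k+r≡n      = trans (ℕₚ.+-suc P.k P.r) (cong suc P.k+r≡n)
      ; check      = consₗ P.check
      ; check-ker  = λ { (x ∷ v) eq → check-ker x v (Vecₚ.∷-injective eq) }
      ; coords     = P.coords ∘ₗ tailₗ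
      ; coords-ker = λ { {x ∷ v} x∷v∈ eq → coords-ker x v x∷v∈ eq }
      }
      where
      check-ker : ∀ x v → x ≡ 0# × apply P.check v ≡ 𝟎 → x ∷ v ∈ₛ S
      check-ker x v (refl , eq) = ∈-section⁻ S (P.check-ker v eq)
      coords-ker : ∀ x v → x ∷ v ∈ₛ S → apply P.coords v ≡ 𝟎 → x ∷ v ≡ 𝟎
      coords-ker x v x∷v∈ eq with headsZero x∷v∈
      ... | refl = cong (0# ∷_) (P.coords-ker (∈-section⁺ S x∷v∈) eq)

    parityCheck-pivot : ∀ {w} → 1# ∷ w ∈ₛ S → ParityCheck S
    parityCheck-pivot {w} pivot∈ = record
      { r          = P.r
      ; k          = suc P.k
      ; k+r≡n      = cong suc P.k+r≡n
      ; check      = P.check ∘ₗ tailₗ ∘ₗ shearₗ w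
      ; check-ker  = λ { (x ∷ v) eq → unsheared∈ x v (P.check-ker _ eq) }
      ; coords     = consₗ P.coords ∘ₗ shearₗ w
      ; coords-ker = λ { {x ∷ v} x∷v∈ eq → coords-ker x v x∷v∈ (Vecₚ.∷-injective eq) }
      }
      where
      sheared∈ : ∀ x v → x ∷ v ∈ₛ S → v ⊞ - x ⊡ w ∈ₛ section S
      sheared∈ x v x∷v∈ = ∈-section⁺ S (subst (λ z → z ∷ v ⊞ - x ⊡ w ∈ₛ S)
        (trans (cong (x +_) (*-identityʳ (- x))) (-‿inverseʳ x))
        (⊞-closed S x∷v∈ (⊡-closed S (- x) pivot∈)))
      unsheared∈ : ∀ x v → v ⊞ - x ⊡ w ∈ₛ section S → x ∷ v ∈ₛ S
      unsheared∈ x v v′∈ = subst (_∈ₛ S)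
        (cong₂ _∷_ (trans (+-identityˡ (x * 1#)) (*-identityʳ x)) (unshear-⊞ v w x))
        (⊞-closed S (∈-section⁻ S v′∈) (⊡-closed S x pivot∈))
      coords-ker : ∀ x v → x ∷ v ∈ₛ S → x ≡ 0# × apply P.coords (v ⊞ - x ⊡ w) ≡ 𝟎 → x ∷ v ≡ 𝟎
      coords-ker x v x∷v∈ (refl , eq) = cong (0# ∷_) (begin
        v                              ≡⟨ unshear-⊞ v w 0# ⟨
        (v ⊞ - 0# ⊡ w) ⊞ 0# ⊡ w        ≡⟨ cong₂ _⊞_ (P.coords-ker (sheared∈ 0# v x∷v∈) eq) (⊡-zeroˡ w) ⟩
        𝟎 ⊞ 𝟎                          ≡⟨ ⊞-identityˡ 𝟎 ⟩
        𝟎                              ∎)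

  parityCheck : ∀ {n} (S : Subspace n) → ParityCheck S
  parityCheck {zero} S = record
    { r = 0 ; k = 0 ; k+r≡n = refl
    ; check  = idₗ ; check-ker  = λ { [] _ → 𝟎∈ S }
    ; coords = idₗ ; coords-ker = λ { {[]} _ _ → refl }
    }
  parityCheck {suc n} S with Any.any? (¬? ∘ head≟0) (elements S)
  ... | yes some = parityCheck-pivot (parityCheck (section S)) (proj₂ (normalisedPivot S some))
  ... | no none  = parityCheck-allHeadsZero (parityCheck (section S)) headsZero
    where
    headsZero : ∀ {x v} → x ∷ v ∈ₛ S → x ≡ 0#
    headsZero {x} {v} x∷v∈ = decidable-stable (x ≟ 0#) (λ x≢0 → none (Any.map (λ { refl → x≢0 }) x∷v∈))

  instance
    q-nonZero : NonZero q
    q-nonZero with Inverse.from enum 0#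
    ... | zero  = _
    ... | suc _ = _

  enum⁻¹-injective : ∀ {x y} → Inverse.from enum x ≡ Inverse.from enum y → x ≡ y
  enum⁻¹-injective {x} {y} eq = begin
    x                                      ≡⟨ Inverse.strictlyInverseˡ enum x ⟨
    Inverse.to enum (Inverse.from enum x)  ≡⟨ cong (Inverse.to enum) eq ⟩
    Inverse.to enum (Inverse.from enum y)  ≡⟨ Inverse.strictlyInverseˡ enum y ⟩
    y                                      ∎

  encode : ∀ {m} → Vt m → Fin (q ℕ.^ m)
  encode []      = zero
  encode (x ∷ v) = combine (Inverse.from enum x) (encode v)

  encode-injective : ∀ {m} (v u : Vt m) → encode v ≡ encode u → v ≡ u
  encode-injective []      []      _  = refl
  encode-injective (x ∷ v) (y ∷ u) eq
    with Finₚ.combine-injective (Inverse.from enum x) (encode v) (Inverse.from enum y) (encode u) eq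
  ... | x≡y , v≡u = cong₂ _∷_ (enum⁻¹-injective x≡y) (encode-injective v u v≡u)

  unique-lookup-injective : ∀ {A : Set} {xs : List A} → Unique xs →
                            ∀ i j → List.lookup xs i ≡ List.lookup xs j → i ≡ j
  unique-lookup-injective (_  ∷ _) zero    zero    _  = refl
  unique-lookup-injective (x∉ ∷ _) zero    (suc j) eq = contradiction eq (All.lookup x∉ (∈ₚ.∈-lookup j))
  unique-lookup-injective (x∉ ∷ _) (suc i) zero    eq = contradiction (sym eq) (All.lookup x∉ (∈ₚ.∈-lookup i))
  unique-lookup-injective (_  ∷ u) (suc i) (suc j) eq = cong suc (unique-lookup-injective u i j eq)

  -- Pigeonhole through the injection encode ∘ f into Fin (q ^ m).
  length-≤-q^ : ∀ {n m} (xs : List (Vt n)) → Unique xs → (f : Vt n → Vt m) →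
                (∀ {x y} → x ∈ xs → y ∈ xs → f x ≡ f y → x ≡ y) → List.length xs ≤ q ℕ.^ m
  length-≤-q^ {m = m} xs xs-unique f f-injective with List.length xs ℕₚ.≤? q ℕ.^ m
  ... | yes ≤q^m = ≤q^m
  ... | no  ≰q^m with Finₚ.pigeonhole (ℕₚ.≰⇒> ≰q^m) (λ i → encode (f (List.lookup xs i)))
  ...   | i , j , i<j , eq = contradiction
    (unique-lookup-injective xs-unique i j
      (f-injective (∈ₚ.∈-lookup i) (∈ₚ.∈-lookup j) (encode-injective _ _ eq)))
    (λ i≡j → ℕₚ.<-irrefl (cong toℕ i≡j) i<j)

  code-size-≤ : ∀ {n m} (C : LinearCode 𝔽 n) (f : Linear n m) →
                (∀ {x} → x ∈ LinearCode.words C → apply f x ≡ 𝟎 → x ≡ 𝟎) →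
                List.length (LinearCode.words C) ≤ q ℕ.^ m
  code-size-≤ C f ker = length-≤-q^ words unique (apply f) λ {x} {y} x∈ y∈ fx≡fy →
    ⊟≡𝟎⇒≡ x y (ker (⊟-closed (codeSubspace C) x∈ y∈)
      (trans (⊟-hom f x y) (trans (cong (_⊟ apply f y) fx≡fy) (⊟-self (apply f y)))))
    where open LinearCode C

  singleton-bound : ∀ {n} d (C : LinearCode 𝔽 n) → MinDist≥ 𝔽 C (d ℕ.+ 1) →
                    List.length (LinearCode.words C) ≤ q ℕ.^ (n ∸ d)
  singleton-bound {n} d C d+1≤wt = code-size-≤ C (dropₗ d) ker
    where
    ker : ∀ {x} → x ∈ LinearCode.words C → dropV d x ≡ 𝟎 → x ≡ 𝟎
    ker {x} x∈ eq = decidable-stable (Vecₚ.≡-dec _≟_ x 𝟎) λ x≢𝟎 →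
      ℕₚ.m+1+n≰m d (ℕₚ.≤-trans (d+1≤wt x∈ x≢𝟎) (ℕₚ.≤-trans (wt-dropV d x) (ℕₚ.≤-reflexive (begin
        d ℕ.+ wt 𝔽 (dropV d x)  ≡⟨ cong (λ v → d ℕ.+ wt 𝔽 v) eq ⟩
        d ℕ.+ wt 𝔽 (𝟎 {n ∸ d})  ≡⟨ cong (d ℕ.+_) (wt-𝟎 (n ∸ d)) ⟩
        d ℕ.+ 0                 ≡⟨ ℕₚ.+-identityʳ d ⟩
        d                       ∎))))

  bit : Bool → F
  bit true  = 1#
  bit false = 0#

  indicator : ∀ {n} → Subset n → Vt n
  indicator []      = []
  indicator (b ∷ I) = bit b ∷ indicator I

  indicator-injective : ∀ {n} (I J : Subset n) → indicator I ≡ indicator J → I ≡ J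
  indicator-injective []      []      _  = refl
  indicator-injective (b ∷ I) (c ∷ J) eq =
    cong₂ _∷_ (bit-injective b c (Vecₚ.∷-injectiveˡ eq)) (indicator-injective I J (Vecₚ.∷-injectiveʳ eq))
    where
    bit-injective : ∀ b c → bit b ≡ bit c → b ≡ c
    bit-injective true  true  _  = refl
    bit-injective false false _  = refl
    bit-injective true  false eq = contradiction (sym eq) 0≢1
    bit-injective false true  eq = contradiction eq 0≢1

  wt-indicator-⊟ : ∀ {n} (I J : Subset n) → wt 𝔽 (indicator I ⊟ indicator J) ≤ ∣ I ∣ ℕ.+ ∣ J ∣
  wt-indicator-⊟ []          []          = z≤n
  wt-indicator-⊟ (false ∷ I) (false ∷ J) =
    ℕₚ.≤-trans (ℕₚ.≤-reflexive (wt-0∷ _ _ (x-x≡0 0#))) (wt-indicator-⊟ I J)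
  wt-indicator-⊟ (true ∷ I)  (c ∷ J)     = ℕₚ.≤-trans (wt-∷-≤ _ _)
    (s≤s (ℕₚ.≤-trans (wt-indicator-⊟ I J) (ℕₚ.+-monoʳ-≤ ∣ I ∣ (Subsetₚ.∣p∣≤∣x∷p∣ c J))))
  wt-indicator-⊟ (false ∷ I) (true ∷ J)  = ℕₚ.≤-trans (wt-∷-≤ _ _)
    (ℕₚ.≤-trans (s≤s (wt-indicator-⊟ I J)) (ℕₚ.≤-reflexive (sym (ℕₚ.+-suc ∣ I ∣ ∣ J ∣))))

  unitVectors : ∀ n → Vec (Vt n) n
  unitVectors zero    = []
  unitVectors (suc n) = (1# ∷ 𝟎) ∷ Vec.map (0# ∷_) (unitVectors n)

  subsetSum-map : ∀ {n m k} (f : Linear n m) (I : Subset k) (xs : Vec (Vt n) k) →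
                  subsetSum 𝔽 I (Vec.map (apply f) xs) ≡ apply f (subsetSum 𝔽 I xs)
  subsetSum-map f []          []       = sym (0-hom f)
  subsetSum-map f (true  ∷ I) (x ∷ xs) = trans (cong (apply f x ⊞_) (subsetSum-map f I xs)) (sym (+-hom f _ _))
  subsetSum-map f (false ∷ I) (x ∷ xs) = subsetSum-map f I xs

  subsetSum-unitVectors : ∀ {n} (I : Subset n) → subsetSum 𝔽 I (unitVectors n) ≡ indicator I
  subsetSum-unitVectors []          = refl
  subsetSum-unitVectors (true ∷ I)  = begin
    (1# ∷ 𝟎) ⊞ subsetSum 𝔽 I (Vec.map (0# ∷_) (unitVectors _))  ≡⟨ cong ((1# ∷ 𝟎) ⊞_) (subsetSum-map 0∷ₗ I _) ⟩
    (1# + 0#) ∷ 𝟎 ⊞ subsetSum 𝔽 I (unitVectors _)               ≡⟨ cong₂ _∷_ (+-identityʳ 1#) (⊞-identityˡ _) ⟩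
    1# ∷ subsetSum 𝔽 I (unitVectors _)                           ≡⟨ cong (1# ∷_) (subsetSum-unitVectors I) ⟩
    1# ∷ indicator I                                             ∎
  subsetSum-unitVectors (false ∷ I) =
    trans (subsetSum-map 0∷ₗ I _) (cong (0# ∷_) (subsetSum-unitVectors I))

  subsetSum-𝟎∷ : ∀ {n k} b (I : Subset k) (xs : Vec (Vt n) k) → subsetSum 𝔽 (b ∷ I) (𝟎 ∷ xs) ≡ subsetSum 𝔽 I xs
  subsetSum-𝟎∷ true  I xs = ⊞-identityˡ _
  subsetSum-𝟎∷ false I xs = refl

  subsetSum-⊥ : ∀ {n k} (xs : Vec (Vt n) k) → subsetSum 𝔽 Subset.⊥ xs ≡ 𝟎
  subsetSum-⊥ []       = refl
  subsetSum-⊥ (_ ∷ xs) = subsetSum-⊥ xs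

  subsetSum-⁅⁆ : ∀ {n k} (i : Fin k) (xs : Vec (Vt n) k) → subsetSum 𝔽 ⁅ i ⁆ xs ≡ Vec.lookup xs i
  subsetSum-⁅⁆ zero    (x ∷ xs) = trans (cong (x ⊞_) (subsetSum-⊥ xs)) (⊞-identityʳ x)
  subsetSum-⁅⁆ (suc i) (_ ∷ xs) = subsetSum-⁅⁆ i xs

  ⁅⁆-injective : ∀ {k} {i j : Fin k} → ⁅ i ⁆ ≡ ⁅ j ⁆ → i ≡ j
  ⁅⁆-injective {i = i} {j} eq = Subsetₚ.x∈⁅y⁆⇒x≡y j (subst (i Subset.∈_) eq (Subsetₚ.x∈⁅x⁆ i))

  ∣x∷p∣≡∣y∷p∣⇒x≡y : ∀ {k} x y (p : Subset k) → ∣ x ∷ p ∣ ≡ ∣ y ∷ p ∣ → x ≡ y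
  ∣x∷p∣≡∣y∷p∣⇒x≡y true  true  p _  = refl
  ∣x∷p∣≡∣y∷p∣⇒x≡y false false p _  = refl
  ∣x∷p∣≡∣y∷p∣⇒x≡y true  false p eq = contradiction eq ℕₚ.1+n≢n
  ∣x∷p∣≡∣y∷p∣⇒x≡y false true  p eq = contradiction (sym eq) ℕₚ.1+n≢n

  ker_⊆_ : ∀ {n m} → Linear n m → LinearCode 𝔽 n → Set
  ker s ⊆ C = ∀ x → apply s x ≡ 𝟎 → x ∈ LinearCode.words C

  indicators-separated : ∀ {n m} d (C : LinearCode 𝔽 n) (s : Linear n m) → ker s ⊆ C →
                         MinDist≥ 𝔽 C (d ℕ.+ 1) → ∀ (I J : Subset n) → ∣ I ∣ ℕ.+ ∣ J ∣ ≤ d →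
                         apply s (indicator I) ≡ apply s (indicator J) → I ≡ J
  indicators-separated d C s ker⊆C d+1≤wt I J size≤d sI≡sJ =
    decidable-stable (Vecₚ.≡-dec Bool._≟_ I J) λ I≢J →
      ℕₚ.m+1+n≰m d (ℕₚ.≤-trans (d+1≤wt c∈C (c≢𝟎 I≢J)) (ℕₚ.≤-trans (wt-indicator-⊟ I J) size≤d))
    where
    c = indicator I ⊟ indicator J
    c∈C : c ∈ LinearCode.words C
    c∈C = ker⊆C c (trans (⊟-hom s _ _) (trans (cong (_⊟ apply s (indicator J)) sI≡sJ) (⊟-self _)))
    c≢𝟎 : I ≢ J → c ≢ 𝟎
    c≢𝟎 I≢J c≡𝟎 = I≢J (indicator-injective I J (⊟≡𝟎⇒≡ _ _ c≡𝟎))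

  shSet-of-parityCheck : ∀ {n m} h (C : LinearCode 𝔽 n) → 1 ≤ h → MinDist≥ 𝔽 C (2 ℕ.* h ℕ.+ 1) →
                         (s : Linear n m) → ker s ⊆ C → HasShSet 𝔽 h (suc n) m
  shSet-of-parityCheck {n} h C 1≤h 2h+1≤wt s ker⊆C = points , points-injective , sums-injective
    where
    points = Vec.map (apply s) (𝟎 ∷ unitVectors n)

    sum-points : ∀ b (I : Subset n) → subsetSum 𝔽 (b ∷ I) points ≡ apply s (indicator I)
    sum-points b I = trans (subsetSum-map s (b ∷ I) _)
      (cong (apply s) (trans (subsetSum-𝟎∷ b I _) (subsetSum-unitVectors I)))

    equal-sums : ∀ I J → ∣ I ∣ ≡ ∣ J ∣ → ∣ I ∣ ≤ h → subsetSum 𝔽 I points ≡ subsetSum 𝔽 J points → I ≡ J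
    equal-sums (b ∷ I) (c ∷ J) ∣bI∣≡∣cJ∣ ∣bI∣≤h eq
      with indicators-separated (2 ℕ.* h) C s ker⊆C 2h+1≤wt I J sizes≤2h
             (trans (sym (sum-points b I)) (trans eq (sum-points c J)))
      where
      sizes≤2h : ∣ I ∣ ℕ.+ ∣ J ∣ ≤ 2 ℕ.* h
      sizes≤2h = ℕₚ.≤-trans
        (ℕₚ.+-mono-≤ (ℕₚ.≤-trans (Subsetₚ.∣p∣≤∣x∷p∣ b I) ∣bI∣≤h)
                     (ℕₚ.≤-trans (Subsetₚ.∣p∣≤∣x∷p∣ c J) (subst (_≤ h) ∣bI∣≡∣cJ∣ ∣bI∣≤h)))
        (ℕₚ.≤-reflexive (cong (h ℕ.+_) (sym (ℕₚ.+-identityʳ h))))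
    ... | refl = cong (_∷ I) (∣x∷p∣≡∣y∷p∣⇒x≡y b c I ∣bI∣≡∣cJ∣)

    points-injective : ∀ {i j} → Vec.lookup points i ≡ Vec.lookup points j → i ≡ j
    points-injective {i} {j} eq = ⁅⁆-injective (equal-sums ⁅ i ⁆ ⁅ j ⁆
      (trans (Subsetₚ.∣⁅x⁆∣≡1 i) (sym (Subsetₚ.∣⁅x⁆∣≡1 j)))
      (ℕₚ.≤-trans (ℕₚ.≤-reflexive (Subsetₚ.∣⁅x⁆∣≡1 i)) 1≤h)
      (trans (subsetSum-⁅⁆ i points) (trans eq (sym (subsetSum-⁅⁆ j points)))))

    sums-injective : ∀ I J → ∣ I ∣ ≡ h → ∣ J ∣ ≡ h → subsetSum 𝔽 I points ≡ subsetSum 𝔽 J points → I ≡ J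
    sums-injective I J ∣I∣≡h ∣J∣≡h = equal-sums I J (trans ∣I∣≡h (sym ∣J∣≡h)) (ℕₚ.≤-reflexive ∣I∣≡h)

  ker-embed : ∀ {n m D} {C : LinearCode 𝔽 n} (m≤D : m ≤ D) (s : Linear n m) →
              ker s ⊆ C → ker (embedₗ m≤D ∘ₗ s) ⊆ C
  ker-embed m≤D s ker⊆C x eq = ker⊆C x (embed-ker m≤D (apply s x) eq)

  code-size-≤-parityCheck : ∀ {n} (C : LinearCode 𝔽 n) (H : ParityCheck (codeSubspace C)) →
                            List.length (LinearCode.words C) ≤ q ℕ.^ (n ∸ ParityCheck.r H)
  code-size-≤-parityCheck {n} C H =
    subst (λ e → List.length (LinearCode.words C) ≤ q ℕ.^ e) k≡n∸r (code-size-≤ C coords coords-ker)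
    where
    open ParityCheck H
    k≡n∸r : k ≡ n ∸ r
    k≡n∸r = trans (sym (ℕₚ.m+n∸n≡m k r)) (cong (_∸ r) k+r≡n)

  V≤ : ∀ {h n r D} → IsV 𝔽 h n r → 2 ℕ.* h ≤ D → HasShSet 𝔽 h (suc n) D → r ≤ D
  V≤ (_ , _ , _ , minimal) 2h≤D S = ℕₚ.≮⇒≥ (λ D<r → minimal _ 2h≤D D<r S)

  q^∸-antitone : ∀ n {D D′} → D ≤ D′ → q ℕ.^ (n ∸ D′) ≤ q ℕ.^ (n ∸ D)
  q^∸-antitone n D≤D′ = ℕₚ.^-monoʳ-≤ q (ℕₚ.∸-monoʳ-≤ n D≤D′)

open import Data.Nat using (_*_; _+_; _^_)
open import Data.List using (length)

corollary4p2 : ∀ {q : ℕ} (𝔽 : FiniteField q) (h n : ℕ) → 1 ≤ h → 2 * h < n →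
    ∀ (r : ℕ) → IsV 𝔽 h n r →
    ∀ (C : LinearCode 𝔽 n) → MinDist≥ 𝔽 C (2 * h + 1) →
    length (LinearCode.words C) ≤ q ^ (n ∸ r)
corollary4p2 𝔽 h n 1≤h _ r isV C 2h+1≤wt =
  [ (λ 2h≤ρ → ℕₚ.≤-trans (code-size-≤-parityCheck C H)
                (q^∸-antitone n (V≤ isV 2h≤ρ (shSet check check-ker))))
  , (λ ρ≤2h → ℕₚ.≤-trans (singleton-bound (2 * h) C 2h+1≤wt)
                (q^∸-antitone n (V≤ isV ℕₚ.≤-refl
                  (shSet (embedₗ ρ≤2h ∘ₗ check) (ker-embed {C = C} ρ≤2h check check-ker)))))
  ] (ℕₚ.≤-total (2 * h) ρ)
  where
  open Coding 𝔽
  H : ParityCheck (codeSubspace C)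
  H = parityCheck (codeSubspace C)
  open ParityCheck H renaming (r to ρ)
  shSet : ∀ {m} (s : Linear n m) → ker s ⊆ C → HasShSet 𝔽 h (suc n) m
  shSet = shSet-of-parityCheck h C 1≤h 2h+1≤wt
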